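{- Let $\mathsf V$ be a 1ESP variety and $h:\mathbf F_{\mathsf V}(z)\to\prod_{k=1}^m\mathbf E_k$ an algebraic e-generalization problem. A homomorphism $g:\mathbf F_{\mathsf V}(z)\to\mathbf P$, with $\mathbf P$ finitely generated and projective in $\mathsf V$, is a solution of $h$ if and only if $\ker(g)\in\mathscr G(h)$.
   Context: $\mathbf F_{\mathsf V}(z)$ is the 1-generated free algebra of $\mathsf V$. Projective in $\mathsf V$ = retract of a free algebra; exact = isomorphic to a finitely generated subalgebra of a finitely generated free algebra. An algebraic e-generalization problem is a homomorphism $h:\mathbf F_{\mathsf V}(z)\to\prod_{k=1}^m\mathbf E_k$ ($m\ge1$), each $\mathbf E_k$ 1-generated exact, each $p_k\circ h$ surjective. A solution is a homomorphism $g:\mathbf F_{\mathsf V}(z)\to\mathbf P$, $\mathbf P$ finitely generated projective, with $f\circ g=h$ for some homomorphism $f$. $\mathscr G(h)=\{\ker(g):g\text{ a solution of }h\}$. $\mathbf S$ is strongly projective if projective and for every embedding $i:\mathbf S\to\mathbf P$ into a projective $\mathbf P$ there is $j:\mathbf P\to\mathbf S$ with $j\circ i=\mathrm{id}_{\mathbf S}$; $\mathsf V$ is 1ESP if all 1-generated exact algebras of $\mathsf V$ are strongly projective. -}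

module Defs where

open import Level using (0ℓ)
open import Data.Nat using (ℕ; suc)
open import Data.Fin using (Fin)
open import Data.Unit using (⊤)
open import Data.Product using (Σ; ∃; ∃-syntax; _×_; _,_)
open import Relation.Binary using (Rel; IsEquivalence)
open import Function using (_∘_)

record Signature : Set₁ where
  field
    Op    : Set
    arity : Op → ℕ
open Signature public

module _ (S : Signature) where

  data Term (X : Set) : Set where
    var  : X → Term X
    node : (f : Op S) → (Fin (arity S f) → Term X) → Term X

  subst : {X Y : Set} → (X → Term Y) → Term X → Term Y
  subst σ (var x)     = σ x
  subst σ (node f ts) = node f (λ i → subst σ (ts i))

  -- an equational theory; the variety V is the class of its models
  record Theory : Set₁ where
    field
      Eqn : Set
      lhs : Eqn → Term ℕ
      rhs : Eqn → Term ℕ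
  open Theory public

  record Algebra : Set₁ where
    field
      Carrier : Set
      _≈_     : Rel Carrier 0ℓ
      isEquiv : IsEquivalence _≈_
      ⟦_⟧     : (f : Op S) → (Fin (arity S f) → Carrier) → Carrier
      ⟦⟧-cong : ∀ f {xs ys : Fin (arity S f) → Carrier} →
                (∀ i → xs i ≈ ys i) → ⟦ f ⟧ xs ≈ ⟦ f ⟧ ys
  open Algebra public

  eval : (A : Algebra) {X : Set} → (X → Carrier A) → Term X → Carrier A
  eval A ρ (var x)     = ρ x
  eval A ρ (node f ts) = ⟦ A ⟧ f (λ i → eval A ρ (ts i))

  Model : Theory → Algebra → Set
  Model T A = ∀ (e : Eqn T) (ρ : ℕ → Carrier A) →
              _≈_ A (eval A ρ (lhs T e)) (eval A ρ (rhs T e))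

  record Hom (A B : Algebra) : Set where
    field
      fun      : Carrier A → Carrier B
      fun-cong : ∀ {a b} → _≈_ A a b → _≈_ B (fun a) (fun b)
      preserve : ∀ f (xs : Fin (arity S f) → Carrier A) →
                 _≈_ B (fun (⟦ A ⟧ f xs)) (⟦ B ⟧ f (fun ∘ xs))
  open Hom public

  Injective : {A B : Algebra} → Hom A B → Set
  Injective {A} {B} φ = ∀ a b → _≈_ B (fun φ a) (fun φ b) → _≈_ A a b

  Surjective : {A B : Algebra} → Hom A B → Set
  Surjective {A} {B} φ = ∀ (b : Carrier B) → ∃[ a ] _≈_ B (fun φ a) b

  module _ (T : Theory) where

    data _⊢_≈_ {X : Set} : Term X → Term X → Set where
      ≈refl  : ∀ {t} → _⊢_≈_ t t
      ≈sym   : ∀ {s t} → _⊢_≈_ s t → _⊢_≈_ t s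
      ≈trans : ∀ {s t u} → _⊢_≈_ s t → _⊢_≈_ t u → _⊢_≈_ s u
      ≈cong  : ∀ f {ss ts : Fin (arity S f) → Term X} →
               (∀ i → _⊢_≈_ (ss i) (ts i)) → _⊢_≈_ (node f ss) (node f ts)
      ≈ax    : ∀ (e : Eqn T) (σ : ℕ → Term X) →
               _⊢_≈_ (subst σ (lhs T e)) (subst σ (rhs T e))

    Free : Set → Algebra
    Free X = record
      { Carrier = Term X
      ; _≈_     = _⊢_≈_
      ; isEquiv = record { refl = ≈refl ; sym = ≈sym ; trans = ≈trans }
      ; ⟦_⟧     = node
      ; ⟦⟧-cong = ≈cong
      }

    F₁ : Algebra
    F₁ = Free ⊤

    GeneratedBy : (A : Algebra) {n : ℕ} → (Fin n → Carrier A) → Set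
    GeneratedBy A {n} gens =
      ∀ (a : Carrier A) → ∃[ t ] _≈_ A (eval A {Fin n} gens t) a

    FinitelyGenerated : Algebra → Set
    FinitelyGenerated A = ∃[ n ] Σ (Fin n → Carrier A) (GeneratedBy A)

    OneGenerated : Algebra → Set
    OneGenerated A = Σ (Fin 1 → Carrier A) (GeneratedBy A)

    -- projective in V: a member of V that is a retract of a free algebra
    Projective : Algebra → Set₁
    Projective A = Model T A × Σ Set λ X → Σ (Hom A (Free X)) λ i →
      Σ (Hom (Free X) A) λ j → ∀ a → _≈_ A (fun j (fun i a)) a

    -- exact: (a member of V) isomorphic to a finitely generated subalgebra
    -- of a finitely generated free algebra, i.e. finitely generated and
    -- embeddable into some F_V(x_1..x_n)
    Exact : Algebra → Set
    Exact A = Model T A × FinitelyGenerated A ×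
      (∃[ n ] Σ (Hom A (Free (Fin n))) Injective)

    StronglyProjective : Algebra → Set₁
    StronglyProjective A = Projective A ×
      (∀ (P : Algebra) → Projective P → (i : Hom A P) → Injective i →
         Σ (Hom P A) λ j → ∀ a → _≈_ A (fun j (fun i a)) a)

    OneESP : Set₁
    OneESP = ∀ (E : Algebra) → OneGenerated E → Exact E → StronglyProjective E

    Prod : {m : ℕ} → (Fin m → Algebra) → Algebra
    Prod {m} Es = record
      { Carrier = (k : Fin m) → Carrier (Es k)
      ; _≈_     = λ x y → ∀ k → _≈_ (Es k) (x k) (y k)
      ; isEquiv = record
          { refl  = λ k → IsEquivalence.refl (isEquiv (Es k))
          ; sym   = λ p k → IsEquivalence.sym (isEquiv (Es k)) (p k)
          ; trans = λ p q k → IsEquivalence.trans (isEquiv (Es k)) (p k) (q k)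
          }
      ; ⟦_⟧     = λ f xs k → ⟦ Es k ⟧ f (λ i → xs i k)
      ; ⟦⟧-cong = λ f p k → ⟦⟧-cong (Es k) f (λ i → p i k)
      }

    -- h : F_V(z) → ∏_{k=1}^m E_k is an algebraic e-generalization problem
    -- (m ≥ 1 is imposed by writing m as suc m' at the use site)
    IsEGenProblem : {m : ℕ} (Es : Fin m → Algebra) → Hom F₁ (Prod Es) → Set
    IsEGenProblem {m} Es h =
      (∀ k → OneGenerated (Es k) × Exact (Es k)) ×
      (∀ k (y : Carrier (Es k)) → ∃[ t ] _≈_ (Es k) (fun h t k) y)

    IsSolution : {m : ℕ} (Es : Fin m → Algebra) → Hom F₁ (Prod Es) →
                 (P : Algebra) → Hom F₁ P → Set₁
    IsSolution Es h P g =
      FinitelyGenerated P × Projective P ×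
      Σ (Hom P (Prod Es)) λ f →
        ∀ (t : Carrier F₁) → _≈_ (Prod Es) (fun f (fun g t)) (fun h t)

    Ker : {P : Algebra} → Hom F₁ P → Rel (Carrier F₁) 0ℓ
    Ker {P} g s t = _≈_ P (fun g s) (fun g t)

    SameRel : Rel (Carrier F₁) 0ℓ → Rel (Carrier F₁) 0ℓ → Set
    SameRel R Q = ∀ s t → (R s t → Q s t) × (Q s t → R s t)

    In𝒢 : {m : ℕ} (Es : Fin m → Algebra) → Hom F₁ (Prod Es) →
          Rel (Carrier F₁) 0ℓ → Set₁
    In𝒢 Es h θ = Σ Algebra λ P' → Σ (Hom F₁ P') λ g' →
      IsSolution Es h P' g' × SameRel (Ker g') θ

module Submission where

-- If g : F(z) → P is a solution, its kernel is in 𝒢(h) as witnessed by g itself.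
-- Conversely, let g' be a solution with ker g' = ker g, say f' ∘ g' = h.  The image
-- E ≅ F(z)/ker g of g is 1-generated, and it is exact: it is a subalgebra of P, and
-- a finitely generated projective algebra embeds into a finitely generated free one.
-- Since V is 1ESP, the inclusion ι : E → P has a retraction j, and g' factors as
-- ψ ∘ ḡ through the corestriction ḡ : F(z) → E.  Then f = f' ∘ ψ ∘ j satisfies
-- f ∘ g = f' ∘ ψ ∘ j ∘ ι ∘ ḡ = f' ∘ ψ ∘ ḡ = f' ∘ g' = h.

open import Level using (0ℓ)
open import Defs
open import Data.Nat using (ℕ; suc)
open import Data.Fin using (Fin; zero)
open import Data.Unit using (tt)
open import Data.Product using (_×_; _,_; proj₁; proj₂; Σ; ∃-syntax)
open import Relation.Binary using (Setoid)
import Relation.Binary.Reasoning.Setoid as SetoidReasoning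
open import Function using (_∘_; id)

module _ {S : Signature} where

  setoid : Algebra S → Setoid 0ℓ 0ℓ
  setoid A = record { isEquivalence = isEquiv A }

  module ≈ (A : Algebra S) = Setoid (setoid A)
  module ≈-Reasoning (A : Algebra S) = SetoidReasoning (setoid A)

  _∘ₕ_ : {A B C : Algebra S} → Hom S B C → Hom S A B → Hom S A C
  _∘ₕ_ {C = C} ψ φ = record
    { fun      = fun ψ ∘ fun φ
    ; fun-cong = fun-cong ψ ∘ fun-cong φ
    ; preserve = λ f xs → ≈.trans C (fun-cong ψ (preserve φ f xs)) (preserve ψ f _)
    }

  ∘-injective : {A B C : Algebra S} (ψ : Hom S B C) (φ : Hom S A B) →
                Injective S ψ → Injective S φ → Injective S (ψ ∘ₕ φ)
  ∘-injective ψ φ ψ-inj φ-inj a b = φ-inj a b ∘ ψ-inj _ _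

  leftInverse⇒injective : {A B : Algebra S} (φ : Hom S A B) (ψ : Hom S B A) →
                          (∀ a → _≈_ A (fun ψ (fun φ a)) a) → Injective S φ
  leftInverse⇒injective {A} φ ψ ψ∘φ≈id a b φa≈φb = begin
    a                 ≈⟨ ≈.sym A (ψ∘φ≈id a) ⟩
    fun ψ (fun φ a)   ≈⟨ fun-cong ψ φa≈φb ⟩
    fun ψ (fun φ b)   ≈⟨ ψ∘φ≈id b ⟩
    b                 ∎
    where open ≈-Reasoning A

  eval-cong : (A : Algebra S) {X : Set} {ρ ρ' : X → Carrier A} →
              (∀ x → _≈_ A (ρ x) (ρ' x)) →
              ∀ t → _≈_ A (eval S A ρ t) (eval S A ρ' t)
  eval-cong A ρ≈ρ' (var x)     = ρ≈ρ' x
  eval-cong A ρ≈ρ' (node f ts) = ⟦⟧-cong A f (λ i → eval-cong A ρ≈ρ' (ts i))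

  eval-homomorphic : {A B : Algebra S} (φ : Hom S A B) {X : Set}
                     (ρ : X → Carrier A) (t : Term S X) →
                     _≈_ B (fun φ (eval S A ρ t)) (eval S B (fun φ ∘ ρ) t)
  eval-homomorphic {B = B} φ ρ (var x)     = ≈.refl B
  eval-homomorphic {B = B} φ ρ (node f ts) =
    ≈.trans B (preserve φ f _) (⟦⟧-cong B f (λ i → eval-homomorphic φ ρ (ts i)))

  eval-subst : (A : Algebra S) {X Y : Set} (ρ : Y → Carrier A)
               (σ : X → Term S Y) (t : Term S X) →
               _≈_ A (eval S A ρ (subst S σ t)) (eval S A (eval S A ρ ∘ σ) t)
  eval-subst A ρ σ (var x)     = ≈.refl A
  eval-subst A ρ σ (node f ts) = ⟦⟧-cong A f (λ i → eval-subst A ρ σ (ts i))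

  injective⇒model : (T : Theory S) {A B : Algebra S} (ι : Hom S A B) →
                    Injective S ι → Model S T B → Model S T A
  injective⇒model T {A} {B} ι ι-inj B⊨T e ρ = ι-inj _ _ (begin
    fun ι (eval S A ρ (lhs T e))   ≈⟨ eval-homomorphic ι ρ (lhs T e) ⟩
    eval S B (fun ι ∘ ρ) (lhs T e) ≈⟨ B⊨T e (fun ι ∘ ρ) ⟩
    eval S B (fun ι ∘ ρ) (rhs T e) ≈⟨ ≈.sym B (eval-homomorphic ι ρ (rhs T e)) ⟩
    fun ι (eval S A ρ (rhs T e))   ∎)
    where open ≈-Reasoning B

  -- The image of φ, presented as the carrier of A modulo the kernel of φ.
  Image : {A B : Algebra S} → Hom S A B → Algebra S
  Image {A} {B} φ = record
    { Carrier = Carrier A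
    ; _≈_     = λ a b → _≈_ B (fun φ a) (fun φ b)
    ; isEquiv = record { refl = ≈.refl B ; sym = ≈.sym B ; trans = ≈.trans B }
    ; ⟦_⟧     = ⟦ A ⟧
    ; ⟦⟧-cong = λ f φxs≈φys → begin
        fun φ (⟦ A ⟧ f _)   ≈⟨ preserve φ f _ ⟩
        ⟦ B ⟧ f (fun φ ∘ _) ≈⟨ ⟦⟧-cong B f φxs≈φys ⟩
        ⟦ B ⟧ f (fun φ ∘ _) ≈⟨ ≈.sym B (preserve φ f _) ⟩
        fun φ (⟦ A ⟧ f _)   ∎
    }
    where open ≈-Reasoning B

  module Image {A B : Algebra S} (φ : Hom S A B) where

    inclusion : Hom S (Image φ) B
    inclusion = record { fun = fun φ ; fun-cong = id ; preserve = preserve φ }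

    inclusion-injective : Injective S inclusion
    inclusion-injective a b = id

    corestriction : Hom S A (Image φ)
    corestriction = record
      { fun = id ; fun-cong = fun-cong φ ; preserve = λ f xs → ≈.refl B }

    corestriction-surjective : Surjective S corestriction
    corestriction-surjective a = a , ≈.refl B

    factor : {C : Algebra S} (ψ : Hom S A C) →
             (∀ a b → _≈_ B (fun φ a) (fun φ b) → _≈_ C (fun ψ a) (fun ψ b)) →
             Hom S (Image φ) C
    factor ψ kerφ⊆kerψ = record
      { fun = fun ψ ; fun-cong = kerφ⊆kerψ _ _ ; preserve = preserve ψ }

module _ {S : Signature} (T : Theory S) where

  ⊢-sound : (A : Algebra S) → Model S T A → {X : Set} (ρ : X → Carrier A)
            {s t : Term S X} → _⊢_≈_ S T s t → _≈_ A (eval S A ρ s) (eval S A ρ t)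
  ⊢-sound A A⊨T ρ ≈refl         = ≈.refl A
  ⊢-sound A A⊨T ρ (≈sym p)      = ≈.sym A (⊢-sound A A⊨T ρ p)
  ⊢-sound A A⊨T ρ (≈trans p q)  = ≈.trans A (⊢-sound A A⊨T ρ p) (⊢-sound A A⊨T ρ q)
  ⊢-sound A A⊨T ρ (≈cong f ps)  = ⟦⟧-cong A f (λ i → ⊢-sound A A⊨T ρ (ps i))
  ⊢-sound A A⊨T ρ (≈ax e σ)     = begin
    eval S A ρ (subst S σ (lhs T e))   ≈⟨ eval-subst A ρ σ (lhs T e) ⟩
    eval S A (eval S A ρ ∘ σ) (lhs T e) ≈⟨ A⊨T e (eval S A ρ ∘ σ) ⟩
    eval S A (eval S A ρ ∘ σ) (rhs T e) ≈⟨ ≈.sym A (eval-subst A ρ σ (rhs T e)) ⟩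
    eval S A ρ (subst S σ (rhs T e))   ∎
    where open ≈-Reasoning A

  evalHom : (A : Algebra S) → Model S T A → {X : Set} → (X → Carrier A) →
            Hom S (Free S T X) A
  evalHom A A⊨T ρ = record
    { fun = eval S A ρ ; fun-cong = ⊢-sound A A⊨T ρ ; preserve = λ f xs → ≈.refl A }

  eval-Free≈subst : {X Y : Set} (σ : Y → Term S X) (t : Term S Y) →
                    _⊢_≈_ S T (eval S (Free S T X) σ t) (subst S σ t)
  eval-Free≈subst σ (var y)     = ≈refl
  eval-Free≈subst σ (node f ts) = ≈cong f (λ i → eval-Free≈subst σ (ts i))

  eval-var : {X : Set} (t : Term S X) → _⊢_≈_ S T (eval S (Free S T X) var t) t
  eval-var (var x)     = ≈refl
  eval-var (node f ts) = ≈cong f (λ i → eval-var (ts i))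

  Free-model : {X : Set} → Model S T (Free S T X)
  Free-model e σ = ≈trans (eval-Free≈subst σ (lhs T e))
                     (≈trans (≈ax e σ) (≈sym (eval-Free≈subst σ (rhs T e))))

  F₁-oneGenerated : OneGenerated S T (F₁ S T)
  F₁-oneGenerated = (λ _ → var tt) , λ t → subst S (λ _ → var zero) t , (begin
    eval S F (λ _ → var tt) (subst S (λ _ → var zero) t) ≈⟨ eval-subst F _ _ t ⟩
    eval S F var t                                       ≈⟨ eval-var t ⟩
    t                                                    ∎)
    where
    F : Algebra S
    F = F₁ S T
    open ≈-Reasoning F

  surjective-generatedBy : {A B : Algebra S} {n : ℕ} {gens : Fin n → Carrier A} →
                           (φ : Hom S A B) → Surjective S φ →
                           GeneratedBy S T A gens → GeneratedBy S T B (fun φ ∘ gens)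
  surjective-generatedBy {A} {B} {gens = gens} φ φ-surj A-gen b =
    let a , φa≈b = φ-surj b
        t , t≈a  = A-gen a
    in t , (begin
      eval S B (fun φ ∘ gens) t ≈⟨ ≈.sym B (eval-homomorphic φ gens t) ⟩
      fun φ (eval S A gens t)   ≈⟨ fun-cong φ t≈a ⟩
      fun φ a                   ≈⟨ φa≈b ⟩
      b                         ∎)
    where open ≈-Reasoning B

  -- Free algebras are projective: ψ lifts along the surjection onto P given by gens.
  Free-lift : {P : Algebra S} {n : ℕ} {gens : Fin n → Carrier P} {X : Set} →
              Model S T P → GeneratedBy S T P gens → (ψ : Hom S (Free S T X) P) →
              Σ (Hom S (Free S T X) (Free S T (Fin n))) λ σ →
                ∀ t → _≈_ P (eval S P gens (fun σ t)) (fun ψ t)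
  Free-lift {P} {n} {gens} {X} P⊨T P-gen ψ = evalHom Fₙ Free-model τ , lifts
    where
    Fₙ : Algebra S
    Fₙ = Free S T (Fin n)
    τ : X → Term S (Fin n)
    τ x = proj₁ (P-gen (fun ψ (var x)))
    open ≈-Reasoning P
    lifts : ∀ t → _≈_ P (eval S P gens (eval S Fₙ τ t)) (fun ψ t)
    lifts t = begin
      eval S P gens (eval S Fₙ τ t)          ≈⟨ eval-homomorphic (evalHom P P⊨T gens) τ t ⟩
      eval S P (eval S P gens ∘ τ) t         ≈⟨ eval-cong P (proj₂ ∘ P-gen ∘ fun ψ ∘ var) t ⟩
      eval S P (fun ψ ∘ var) t               ≈⟨ ≈.sym P (eval-homomorphic ψ var t) ⟩
      fun ψ (eval S (Free S T X) var t)      ≈⟨ fun-cong ψ (eval-var t) ⟩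
      fun ψ t                                ∎

  fgProjective⇒embedsInFree : {P : Algebra S} →
    FinitelyGenerated S T P → Projective S T P →
    ∃[ n ] Σ (Hom S P (Free S T (Fin n))) (Injective S)
  fgProjective⇒embedsInFree {P} (n , gens , P-gen) (P⊨T , X , i , j , j∘i≈id) =
    n , σ ∘ₕ i , leftInverse⇒injective (σ ∘ₕ i) (evalHom P P⊨T gens) π∘σ∘i≈id
    where
    σ : Hom S (Free S T X) (Free S T (Fin n))
    σ = proj₁ (Free-lift P⊨T P-gen j)
    π∘σ∘i≈id : ∀ a → _≈_ P (eval S P gens (fun σ (fun i a))) a
    π∘σ∘i≈id a = ≈.trans P (proj₂ (Free-lift P⊨T P-gen j) (fun i a)) (j∘i≈id a)

  image-exact : {A B : Algebra S} (φ : Hom S A B) →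
                FinitelyGenerated S T A → Model S T B →
                ∃[ n ] Σ (Hom S B (Free S T (Fin n))) (Injective S) →
                Exact S T (Image φ)
  image-exact φ (k , gens , A-gen) B⊨T (n , ε , ε-inj) =
    injective⇒model T inclusion inclusion-injective B⊨T ,
    (k , gens , surjective-generatedBy corestriction corestriction-surjective A-gen) ,
    (n , ε ∘ₕ inclusion , ∘-injective ε inclusion ε-inj inclusion-injective)
    where open Image φ

  solution-of-finer-kernel : OneESP S T → {m : ℕ} (Es : Fin m → Algebra S)
    (h : Hom S (F₁ S T) (Prod S T Es)) →
    (P : Algebra S) → FinitelyGenerated S T P → Projective S T P →
    (g : Hom S (F₁ S T) P) (P' : Algebra S) (g' : Hom S (F₁ S T) P') →
    IsSolution S T Es h P' g' →
    (∀ s t → Ker S T g s t → Ker S T g' s t) →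
    IsSolution S T Es h P g
  solution-of-finer-kernel V-1ESP Es h P P-fg P-proj g P' g' (_ , _ , f' , f'∘g'≈h) kerg⊆kerg' =
    P-fg , P-proj , f' ∘ₕ (ψ ∘ₕ j) , λ t → begin
      fun f' (fun ψ (fun j (fun g t))) ≈⟨ fun-cong f' (kerg⊆kerg' _ _ (j∘ι≈id t)) ⟩
      fun f' (fun g' t)                ≈⟨ f'∘g'≈h t ⟩
      fun h t                          ∎
    where
    open Image g
    open ≈-Reasoning (Prod S T Es)
    E-oneGenerated : OneGenerated S T (Image g)
    E-oneGenerated = _ , surjective-generatedBy corestriction corestriction-surjective
                           (proj₂ F₁-oneGenerated)
    E-exact : Exact S T (Image g)
    E-exact = image-exact g (1 , F₁-oneGenerated) (proj₁ P-proj)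
                (fgProjective⇒embedsInFree P-fg P-proj)
    retraction : Σ (Hom S P (Image g)) λ j →
                   ∀ t → _≈_ (Image g) (fun j (fun inclusion t)) t
    retraction = proj₂ (V-1ESP (Image g) E-oneGenerated E-exact)
                   P P-proj inclusion inclusion-injective
    j : Hom S P (Image g)
    j = proj₁ retraction
    j∘ι≈id : ∀ t → _≈_ P (fun g (fun j (fun g t))) (fun g t)
    j∘ι≈id = proj₂ retraction
    ψ : Hom S (Image g) P'
    ψ = factor g' kerg⊆kerg'

theorem4p12 : (S : Signature) (T : Theory S) → OneESP S T →
    (m : ℕ) (Es : Fin (suc m) → Algebra S) (h : Hom S (F₁ S T) (Prod S T Es)) →
    IsEGenProblem S T Es h →
    (P : Algebra S) → FinitelyGenerated S T P → Projective S T P →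
    (g : Hom S (F₁ S T) P) →
    (IsSolution S T Es h P g → In𝒢 S T Es h (Ker S T g)) ×
    (In𝒢 S T Es h (Ker S T g) → IsSolution S T Es h P g)
theorem4p12 S T V-1ESP m Es h _ P P-fg P-proj g =
  (λ g-sol → P , g , g-sol , λ s t → id , id) ,
  (λ (P' , g' , g'-sol , kerg'≡kerg) →
     solution-of-finer-kernel T V-1ESP Es h P P-fg P-proj g P' g' g'-sol
       (λ s t → proj₂ (kerg'≡kerg s t)))
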